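{- Let $L$ be a $\mathbb{Z}_p$-lattice and $N$ a primitive sublattice of $L$. Suppose that $v\in L$ is such that $\mathbb{Z}_p[v]$ is an orthogonal summand of $L$ and $B(v,N)=0$. If $w\in L$ satisfies $B(w,\mathbb{Z}_p[v]\perp N)=0$, then $N\perp\mathbb{Z}_p[v+w]$ is a primitive sublattice of $L$.
   Context: $L$ is a lattice over $\mathbb{Z}_p$ with bilinear form $B$; a sublattice is primitive if it is a direct summand of $L$. $\mathbb{Z}_p[x_1,\dots,x_k]$ denotes the $\mathbb{Z}_p$-span of $x_1,\dots,x_k$. -}

module Defs where

open import Data.Nat as ℕ using (ℕ; zero; suc; _^_)
open import Data.Integer as ℤ using (ℤ; +_; _+_; _*_; -_; _-_)
open import Data.Integer.Divisibility.Signed using (_∣_; divides; ∣m∣n⇒∣m+n; ∣m⇒∣-m; ∣n⇒∣m*n; ∣m⇒∣m*n; ∣-refl)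
open import Data.Integer.Solver using (module +-*-Solver)
open import Data.Fin using (Fin; zero; suc)
open import Data.Product using (Σ; ∃; _×_; _,_)
open import Relation.Binary.PropositionalEquality using (_≡_; refl; subst; sym)
open import Relation.Nullary using (¬_)

-- The p-adic integers ℤ_p as the inverse limit lim ℤ/p^n ℤ:
-- coherent sequences of integers (x n) with x (n+1) ≡ x n (mod p^n),
-- with equality ≈ meaning x n ≡ y n (mod p^n) for all n.

_≡_[mod_] : ℤ → ℤ → ℤ → Set
a ≡ b [mod m ] = m ∣ (a - b)

record ℤp (p : ℕ) : Set where
  constructor mkℤp
  field
    res : ℕ → ℤ
    coh : ∀ n → res (suc n) ≡ res n [mod + (p ^ n) ]
open ℤp public

module _ {p : ℕ} where

  infix 4 _≈_
  _≈_ : ℤp p → ℤp p → Set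
  x ≈ y = ∀ n → res x n ≡ res y n [mod + (p ^ n) ]

  private
    open +-*-Solver
    add-id : ∀ a' a b' b → (a' + b') - (a + b) ≡ (a' - a) + (b' - b)
    add-id = solve 4 (λ a' a b' b → (a' :+ b') :- (a :+ b) := (a' :- a) :+ (b' :- b)) refl
    neg-id : ∀ a' a → (- a') - (- a) ≡ - (a' - a)
    neg-id = solve 2 (λ a' a → (:- a') :- (:- a) := :- (a' :- a)) refl
    mul-id : ∀ a' a b' b → (a' * b') - (a * b) ≡ a' * (b' - b) + (a' - a) * b
    mul-id = solve 4 (λ a' a b' b → (a' :* b') :- (a :* b) := a' :* (b' :- b) :+ (a' :- a) :* b) refl

  0ₚ : ℤp p
  0ₚ = mkℤp (λ _ → + 0) (λ n → divides (+ 0) refl)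

  infixl 6 _+ₚ_
  infixl 7 _*ₚ_
  _+ₚ_ : ℤp p → ℤp p → ℤp p
  x +ₚ y = mkℤp (λ n → res x n + res y n) λ n →
    subst (_ ∣_) (sym (add-id (res x (suc n)) (res x n) (res y (suc n)) (res y n)))
      (∣m∣n⇒∣m+n (coh x n) (coh y n))

  -ₚ_ : ℤp p → ℤp p
  -ₚ x = mkℤp (λ n → - res x n) λ n →
    subst (_ ∣_) (sym (neg-id (res x (suc n)) (res x n))) (∣m⇒∣-m (coh x n))

  _*ₚ_ : ℤp p → ℤp p → ℤp p
  x *ₚ y = mkℤp (λ n → res x n * res y n) λ n →
    subst (_ ∣_) (sym (mul-id (res x (suc n)) (res x n) (res y (suc n)) (res y n)))
      (∣m∣n⇒∣m+n (∣n⇒∣m*n (res x (suc n)) (coh y n)) (∣m⇒∣m*n (res y n) (coh x n)))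

-- Lattices: a ℤ_p-lattice of rank n is ℤ_p^n (Fin n → ℤ_p) with a
-- symmetric bilinear form B given by a Gram matrix G (B(x,y) = xᵀ G y),
-- assumed nondegenerate.

module _ {p : ℕ} where

  Σₚ : ∀ {k} → (Fin k → ℤp p) → ℤp p
  Σₚ {zero}  f = 0ₚ
  Σₚ {suc k} f = f zero +ₚ Σₚ (λ i → f (suc i))

  Vecₚ : ℕ → Set
  Vecₚ n = Fin n → ℤp p

  Gram : ℕ → Set
  Gram n = Fin n → Fin n → ℤp p

  module _ {n : ℕ} where

    infix 4 _≈ᵥ_
    _≈ᵥ_ : Vecₚ n → Vecₚ n → Set
    x ≈ᵥ y = ∀ i → x i ≈ y i

    0ᵥ : Vecₚ n
    0ᵥ _ = 0ₚ

    infixl 6 _+ᵥ_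
    _+ᵥ_ : Vecₚ n → Vecₚ n → Vecₚ n
    (x +ᵥ y) i = x i +ₚ y i

    infixl 7 _·ᵥ_
    _·ᵥ_ : ℤp p → Vecₚ n → Vecₚ n
    (a ·ᵥ x) i = a *ₚ x i

    B : Gram n → Vecₚ n → Vecₚ n → ℤp p
    B G x y = Σₚ (λ i → Σₚ (λ j → x i *ₚ G i j *ₚ y j))

    Symmetric : Gram n → Set
    Symmetric G = ∀ i j → G i j ≈ G j i

    Nondegenerate : Gram n → Set
    Nondegenerate G = ∀ x → (∀ y → B G x y ≈ 0ₚ) → x ≈ᵥ 0ᵥ

    -- ℤ_p-linear combinations; sublattices ℤ_p[x_1,…,x_k] are given by
    -- finite generating families x : Fin k → Vecₚ n
    lincomb : ∀ {k} → (Fin k → Vecₚ n) → (Fin k → ℤp p) → Vecₚ n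
    lincomb {zero}  g c = 0ᵥ
    lincomb {suc k} g c = c zero ·ᵥ g zero +ᵥ lincomb (λ i → g (suc i)) (λ i → c (suc i))

    _∈⟨_⟩ : ∀ {k} → Vecₚ n → (Fin k → Vecₚ n) → Set
    x ∈⟨ g ⟩ = Σ (Fin _ → ℤp p) λ c → x ≈ᵥ lincomb g c

    _▹_ : ∀ {k} → (Fin k → Vecₚ n) → Vecₚ n → Fin (suc k) → Vecₚ n
    (g ▹ u) zero    = u
    (g ▹ u) (suc i) = g i

    ⟨_⟩₁ : Vecₚ n → Fin 1 → Vecₚ n
    ⟨ u ⟩₁ _ = u

    DirectSumDecomp : ∀ {k m} → (Fin k → Vecₚ n) → (Fin m → Vecₚ n) → Set
    DirectSumDecomp g h =
      (∀ x → Σ (Vecₚ n) λ a → Σ (Vecₚ n) λ b → a ∈⟨ g ⟩ × b ∈⟨ h ⟩ × x ≈ᵥ a +ᵥ b)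
      × (∀ x → x ∈⟨ g ⟩ → x ∈⟨ h ⟩ → x ≈ᵥ 0ᵥ)

    OrthogonalSum : Gram n → ∀ {k m} → (Fin k → Vecₚ n) → (Fin m → Vecₚ n) → Set
    OrthogonalSum G g h =
      (∀ x y → x ∈⟨ g ⟩ → y ∈⟨ h ⟩ → B G x y ≈ 0ₚ)
      × (∀ x → x ∈⟨ g ⟩ → x ∈⟨ h ⟩ → x ≈ᵥ 0ᵥ)

    Primitive : ∀ {k} → (Fin k → Vecₚ n) → Set
    Primitive g = Σ ℕ λ m → Σ (Fin m → Vecₚ n) λ h → DirectSumDecomp g h

    OrthogonalSummand : Gram n → ∀ {k} → (Fin k → Vecₚ n) → Set
    OrthogonalSummand G g = Σ ℕ λ m → Σ (Fin m → Vecₚ n) λ h →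
      DirectSumDecomp g h × (∀ x y → x ∈⟨ g ⟩ → y ∈⟨ h ⟩ → B G x y ≈ 0ₚ)

-- Write β = B(v,v). Since ℤ_p[v] is an orthogonal summand of L, every value B(v,x) is a
-- multiple γ(x)·β, and nondegeneracy forces β ≠ 0; as ℤ_p is a domain, β can be cancelled.
-- Because w ⊥ v, the vector u = v + w still has B(v,u) = β, so x = γ(x)·u + (x − γ(x)·u)
-- splits L as ℤ_p[u] ⊕ ker B(v,·), and N lies in the kernel, which gives N ⊥ ℤ_p[u].
-- For primitivity, let L = N ⊕ ℤ_p[h] and let k₀ be the ℤ_p[h]-component of u, so that
-- B(v,k₀) = β as well. The vectors h_j − γ(h_j)·k₀ lie in ℤ_p[h] ∩ ker B(v,·) and span it,
-- hence they span a complement of N ⊥ ℤ_p[u] in L.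
module Submission where

open import Defs
open import Level using (0ℓ)
open import Data.Nat as ℕ using (ℕ; zero; suc; NonZero)
import Data.Nat.Properties as ℕ
open import Data.Nat.Primality using (Prime; euclidsLemma; prime⇒nonZero)
open import Data.Integer as ℤ using (ℤ; +_; ∣_∣)
import Data.Integer.Properties as ℤ
open import Data.Integer.Solver using (module +-*-Solver)
open import Data.Fin using (Fin; zero; suc)
open import Data.Vec.Functional using (_∷_)
open import Data.Product using (Σ; _,_; _×_; proj₁; proj₂)
open import Data.Sum using (inj₁; inj₂)
open import Data.Empty using (⊥-elim)
open import Function using (_∘_)
open import Algebra.Bundles using (CommutativeRing)
open import Relation.Binary.Structures using (IsEquivalence)
open import Relation.Binary.PropositionalEquality as ≡ using (_≡_; refl; subst; subst₂; cong; cong₂)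
open import Relation.Nullary using (¬_; yes; no)

module _ {p : ℕ} (p-prime : Prime p) where
  open import Data.Nat.Base using (_^_; _*_; _+_)
  open import Data.Nat.Divisibility
  open import Data.Nat.Properties using (*-comm; *-assoc; ^-distribˡ-+-*)

  private instance
    p≢0 : NonZero p
    p≢0 = prime⇒nonZero p-prime

  p∤m∧pᵏ∣m*n⇒pᵏ∣n : ∀ k {m n} → ¬ p ∣ m → p ^ k ∣ m * n → p ^ k ∣ n
  p∤m∧pᵏ∣m*n⇒pᵏ∣n zero    _   _ = 1∣ _
  p∤m∧pᵏ∣m*n⇒pᵏ∣n (suc k) {m} {n} p∤m pᵏ⁺¹∣mn
    with euclidsLemma m n p-prime (∣-trans (m∣m*n (p ^ k)) pᵏ⁺¹∣mn)
  ... | inj₁ p∣m = ⊥-elim (p∤m p∣m)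
  ... | inj₂ (divides n′ refl) = subst (_∣ n′ * p) (*-comm (p ^ k) p) (*-monoˡ-∣ p pᵏ∣n′)
    where
    pᵏ∣n′ : p ^ k ∣ n′
    pᵏ∣n′ = p∤m∧pᵏ∣m*n⇒pᵏ∣n k p∤m
      (*-cancelʳ-∣ p (subst₂ _∣_ (*-comm p (p ^ k)) (≡.sym (*-assoc m n′ p)) pᵏ⁺¹∣mn))

  pʲ∤m∧pʲ⁺ᵏ∣m*n⇒pᵏ∣n : ∀ j k {m n} → ¬ p ^ j ∣ m → p ^ (j + k) ∣ m * n → p ^ k ∣ n
  pʲ∤m∧pʲ⁺ᵏ∣m*n⇒pᵏ∣n zero    k pʲ∤m _ = ⊥-elim (pʲ∤m (1∣ _))
  pʲ∤m∧pʲ⁺ᵏ∣m*n⇒pᵏ∣n (suc j) k {m} {n} pʲ∤m pʲ⁺ᵏ∣mn with p ∣? m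
  ... | no p∤m = p∤m∧pᵏ∣m*n⇒pᵏ∣n k p∤m (∣-trans pᵏ∣pʲ⁺ᵏ pʲ⁺ᵏ∣mn)
    where
    pᵏ∣pʲ⁺ᵏ : p ^ k ∣ p ^ (suc j + k)
    pᵏ∣pʲ⁺ᵏ = subst (p ^ k ∣_) (≡.sym (^-distribˡ-+-* p (suc j) k)) (n∣m*n (p ^ suc j))
  ... | yes (divides m′ refl) = pʲ∤m∧pʲ⁺ᵏ∣m*n⇒pᵏ∣n j k {m′} pʲ∤m′
      (*-cancelˡ-∣ p (subst (p * p ^ (j + k) ∣_) (≡.trans (cong (_* n) (*-comm m′ p)) (*-assoc p m′ n))
        pʲ⁺ᵏ∣mn))
    where
    pʲ∤m′ : ¬ p ^ j ∣ m′
    pʲ∤m′ pʲ∣m′ = pʲ∤m (subst (_∣ m′ * p) (*-comm (p ^ j) p) (*-monoˡ-∣ p pʲ∣m′))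

module _ {d : ℤ} where
  open import Data.Integer.Divisibility.Signed using (_∣_; divides; ∣m∣n⇒∣m+n; ∣m⇒∣-m; ∣n⇒∣m*n; ∣m⇒∣m*n)
  open +-*-Solver

  ≡[mod]-refl : ∀ a → a ≡ a [mod d ]
  ≡[mod]-refl a = divides (+ 0) (≡.trans (ℤ.+-inverseʳ a) (≡.sym (ℤ.*-zeroˡ d)))

  ≡[mod]-sym : ∀ a b → a ≡ b [mod d ] → b ≡ a [mod d ]
  ≡[mod]-sym a b a≡b = subst (d ∣_) (solve 2 (λ a b → :- (a :- b) := b :- a) refl a b) (∣m⇒∣-m a≡b)

  ≡[mod]-trans : ∀ a b c → a ≡ b [mod d ] → b ≡ c [mod d ] → a ≡ c [mod d ]
  ≡[mod]-trans a b c a≡b b≡c =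
    subst (d ∣_) (solve 3 (λ a b c → (a :- b) :+ (b :- c) := a :- c) refl a b c) (∣m∣n⇒∣m+n a≡b b≡c)

  +-cong-≡[mod] : ∀ a a′ b b′ → a ≡ a′ [mod d ] → b ≡ b′ [mod d ] → (a ℤ.+ b) ≡ (a′ ℤ.+ b′) [mod d ]
  +-cong-≡[mod] a a′ b b′ a≡a′ b≡b′ =
    subst (d ∣_) (solve 4 (λ a a′ b b′ → (a :- a′) :+ (b :- b′) := (a :+ b) :- (a′ :+ b′)) refl a a′ b b′)
      (∣m∣n⇒∣m+n a≡a′ b≡b′)

  neg-cong-≡[mod] : ∀ a a′ → a ≡ a′ [mod d ] → (ℤ.- a) ≡ (ℤ.- a′) [mod d ]
  neg-cong-≡[mod] a a′ a≡a′ =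
    subst (d ∣_) (solve 2 (λ a a′ → :- (a :- a′) := (:- a) :- (:- a′)) refl a a′) (∣m⇒∣-m a≡a′)

  *-cong-≡[mod] : ∀ a a′ b b′ → a ≡ a′ [mod d ] → b ≡ b′ [mod d ] → (a ℤ.* b) ≡ (a′ ℤ.* b′) [mod d ]
  *-cong-≡[mod] a a′ b b′ a≡a′ b≡b′ =
    subst (d ∣_)
      (solve 4 (λ a a′ b b′ → a :* (b :- b′) :+ (a :- a′) :* b′ := (a :* b) :- (a′ :* b′)) refl a a′ b b′)
      (∣m∣n⇒∣m+n (∣n⇒∣m*n a b≡b′) (∣m⇒∣m*n b′ a≡a′))

  ∣⇒≡0[mod] : ∀ a → d ∣ a → a ≡ + 0 [mod d ]
  ∣⇒≡0[mod] a = subst (d ∣_) (≡.sym (ℤ.+-identityʳ a))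

  ≡0[mod]⇒∣ : ∀ a → a ≡ + 0 [mod d ] → d ∣ a
  ≡0[mod]⇒∣ a = subst (d ∣_) (ℤ.+-identityʳ a)

  ∣-resp-≡[mod] : ∀ a b → a ≡ b [mod d ] → d ∣ a → d ∣ b
  ∣-resp-≡[mod] a b a≡b d∣a = ≡0[mod]⇒∣ b (≡[mod]-trans b a (+ 0) (≡[mod]-sym a b a≡b) (∣⇒≡0[mod] a d∣a))

module _ {p : ℕ} where
  open import Data.Integer.Divisibility.Signed using (_∣_; ∣-trans; ∣ᵤ⇒∣; ∣⇒∣ᵤ)

  -- _≈_ unfolds to integer arithmetic, so Agda cannot recover x and y from x ≈ y; this record
  -- makes both sides inferable. The ring operations and B are not injective either, which is why
  -- implicit arguments that only occur under them are supplied explicitly throughout.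
  infix 4 _≃_
  record _≃_ (x y : ℤp p) : Set where
    constructor mk≃
    field ≃⇒≈ : x ≈ y
  open _≃_ public

  1ₚ : ℤp p
  1ₚ = mkℤp (λ _ → + 1) (λ _ → ≡[mod]-refl (+ 1))

  levelwise : ∀ {x y : ℤp p} → (∀ n → res x n ≡ res y n) → x ≃ y
  levelwise {x} eq = mk≃ λ n → subst (res x n ≡_[mod _ ]) (eq n) (≡[mod]-refl (res x n))

  ≃-isEquivalence : IsEquivalence _≃_
  ≃-isEquivalence = record
    { refl  = λ {x} → mk≃ λ n → ≡[mod]-refl (res x n)
    ; sym   = λ {x} {y} (mk≃ x≈y) → mk≃ λ n → ≡[mod]-sym (res x n) (res y n) (x≈y n)
    ; trans = λ {x} {y} {z} (mk≃ x≈y) (mk≃ y≈z) → mk≃ λ n →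
        ≡[mod]-trans (res x n) (res y n) (res z n) (x≈y n) (y≈z n) }

  ℤₚ-commutativeRing : CommutativeRing 0ℓ 0ℓ
  ℤₚ-commutativeRing = record
    { Carrier = ℤp p ; _≈_ = _≃_ ; _+_ = _+ₚ_ ; _*_ = _*ₚ_ ; -_ = -ₚ_ ; 0# = 0ₚ ; 1# = 1ₚ
    ; isCommutativeRing = record
      { isRing = record
        { +-isAbelianGroup = record
          { isGroup = record
            { isMonoid = record
              { isSemigroup = record
                { isMagma = record
                  { isEquivalence = ≃-isEquivalence
                  ; ∙-cong = λ {x} {x′} {y} {y′} (mk≃ x≈x′) (mk≃ y≈y′) → mk≃ λ n →
                      +-cong-≡[mod] (res x n) (res x′ n) (res y n) (res y′ n) (x≈x′ n) (y≈y′ n) }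
                ; assoc = λ x y z → levelwise λ n → ℤ.+-assoc (res x n) (res y n) (res z n) }
              ; identity = (λ x → levelwise λ n → ℤ.+-identityˡ (res x n))
                         , (λ x → levelwise λ n → ℤ.+-identityʳ (res x n)) }
            ; inverse = (λ x → levelwise λ n → ℤ.+-inverseˡ (res x n))
                      , (λ x → levelwise λ n → ℤ.+-inverseʳ (res x n))
            ; ⁻¹-cong = λ {x} {x′} (mk≃ x≈x′) → mk≃ λ n → neg-cong-≡[mod] (res x n) (res x′ n) (x≈x′ n) }
          ; comm = λ x y → levelwise λ n → ℤ.+-comm (res x n) (res y n) }
        ; *-cong = λ {x} {x′} {y} {y′} (mk≃ x≈x′) (mk≃ y≈y′) → mk≃ λ n →
            *-cong-≡[mod] (res x n) (res x′ n) (res y n) (res y′ n) (x≈x′ n) (y≈y′ n)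
        ; *-assoc = λ x y z → levelwise λ n → ℤ.*-assoc (res x n) (res y n) (res z n)
        ; *-identity = (λ x → levelwise λ n → ℤ.*-identityˡ (res x n))
                     , (λ x → levelwise λ n → ℤ.*-identityʳ (res x n))
        ; distrib = (λ x y z → levelwise λ n → ℤ.*-distribˡ-+ (res x n) (res y n) (res z n))
                  , (λ x y z → levelwise λ n → ℤ.*-distribʳ-+ (res x n) (res y n) (res z n)) }
      ; *-comm = λ x y → levelwise λ n → ℤ.*-comm (res x n) (res y n) } }

  coh-+ : ∀ (x : ℤp p) k m → res x (k ℕ.+ m) ≡ res x m [mod + (p ℕ.^ m) ]
  coh-+ x zero    m = ≡[mod]-refl (res x m)
  coh-+ x (suc k) m = ≡[mod]-trans (res x (suc k ℕ.+ m)) (res x (k ℕ.+ m)) (res x m)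
    (∣-trans pᵐ∣pᵏ⁺ᵐ (coh x (k ℕ.+ m))) (coh-+ x k m)
    where
    open import Data.Nat.Divisibility using (n∣m*n) renaming (_∣_ to _∣ᵤ_)
    pᵐ∣pᵏ⁺ᵐ : + (p ℕ.^ m) ∣ + (p ℕ.^ (k ℕ.+ m))
    pᵐ∣pᵏ⁺ᵐ = ∣ᵤ⇒∣ (subst (_ ∣ᵤ_) (≡.sym (ℕ.^-distribˡ-+-* p k m)) (n∣m*n (p ℕ.^ k)))

  NonZeroDivisor : ℤp p → Set
  NonZeroDivisor y = ∀ x → x *ₚ y ≃ 0ₚ → x ≃ 0ₚ

  -- If pⁿ ∤ xₙ then pⁿ ∤ xₙ₊ₘ for every m, so pⁿ⁺ᵐ ∣ xₙ₊ₘ yₙ₊ₘ forces pᵐ ∣ yₙ₊ₘ, i.e. y ≃ 0.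
  ℤₚ-noZeroDivisors : Prime p → ∀ {y} → ¬ y ≃ 0ₚ → NonZeroDivisor y
  ℤₚ-noZeroDivisors p-prime {y} y≄0 x (mk≃ xy≈0) = mk≃ x≈0
    where
    open import Data.Nat.Base using (_^_; _+_)
    open import Data.Nat.Divisibility using (_∣?_) renaming (_∣_ to _∣ᵤ_)
    x≈0 : x ≈ 0ₚ
    x≈0 n with p ^ n ∣? ∣ res x n ∣
    ... | yes pⁿ∣xₙ = ∣⇒≡0[mod] (res x n) (∣ᵤ⇒∣ pⁿ∣xₙ)
    ... | no  pⁿ∤xₙ = ⊥-elim (y≄0 (mk≃ y≈0))
      where
      pⁿ∤xₙ₊ₘ : ∀ m → ¬ p ^ n ∣ᵤ ∣ res x (n + m) ∣
      pⁿ∤xₙ₊ₘ m pⁿ∣xₙ₊ₘ = pⁿ∤xₙ (∣⇒∣ᵤ (∣-resp-≡[mod] (res x (n + m)) (res x n) xₙ₊ₘ≡xₙ (∣ᵤ⇒∣ pⁿ∣xₙ₊ₘ)))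
        where
        xₙ₊ₘ≡xₙ : res x (n + m) ≡ res x n [mod + (p ^ n) ]
        xₙ₊ₘ≡xₙ = subst (λ j → res x j ≡ res x n [mod + (p ^ n) ]) (ℕ.+-comm m n) (coh-+ x m n)
      pᵐ∣yₙ₊ₘ : ∀ m → + (p ^ m) ∣ res y (n + m)
      pᵐ∣yₙ₊ₘ m = ∣ᵤ⇒∣ (pʲ∤m∧pʲ⁺ᵏ∣m*n⇒pᵏ∣n p-prime n m (pⁿ∤xₙ₊ₘ m)
        (subst (_ ∣ᵤ_) (ℤ.abs-* (res x (n + m)) (res y (n + m)))
          (∣⇒∣ᵤ (≡0[mod]⇒∣ (res x (n + m) ℤ.* res y (n + m)) (xy≈0 (n + m))))))
      y≈0 : y ≈ 0ₚ
      y≈0 m = ∣⇒≡0[mod] (res y m) (∣-resp-≡[mod] (res y (n + m)) (res y m) (coh-+ y n m) (pᵐ∣yₙ₊ₘ m))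

module _ {p : ℕ} where
  open CommutativeRing (ℤₚ-commutativeRing {p})
    using ( setoid; semiring; ring; +-commutativeSemigroup; *-commutativeSemigroup
          ; +-cong; +-congˡ; +-congʳ; *-congˡ; *-congʳ; +-assoc; +-comm; *-assoc
          ; +-identityˡ; +-identityʳ; *-identityˡ; zeroˡ; zeroʳ; distribˡ; distribʳ; -‿inverseˡ )
    renaming (refl to ≃-refl; sym to ≃-sym; trans to ≃-trans)
  open import Algebra.Properties.Ring ring using (-‿distribˡ-*)
  open import Algebra.Properties.Semiring.Sum semiring
    using (sum; sum-cong-≋; sum-cong-≗; ∑-distrib-+; ∑-comm; *-distribˡ-sum)
  open import Algebra.Properties.CommutativeSemigroup *-commutativeSemigroup using (xy∙z≈zy∙x; x∙yz≈y∙xz)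
  open import Algebra.Properties.CommutativeSemigroup +-commutativeSemigroup
    using () renaming (interchange to +-interchange)
  open import Relation.Binary.Reasoning.Setoid setoid

  [-a]*b+a*b≃0 : ∀ (a b : ℤp p) → (-ₚ a) *ₚ b +ₚ a *ₚ b ≃ 0ₚ
  [-a]*b+a*b≃0 a b = ≃-trans (+-congʳ {a *ₚ b} (≃-sym (-‿distribˡ-* a b))) (-‿inverseˡ (a *ₚ b))

  Σₚ≡sum : ∀ {k} (f : Fin k → ℤp p) → Σₚ f ≡ sum f
  Σₚ≡sum {zero}  f = ≡.refl
  Σₚ≡sum {suc k} f = cong (f zero +ₚ_) (Σₚ≡sum (f ∘ suc))

  Σₚ-cong : ∀ {k} (f g : Fin k → ℤp p) → (∀ i → f i ≃ g i) → Σₚ f ≃ Σₚ g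
  Σₚ-cong f g f≃g = begin
    Σₚ f  ≡⟨ Σₚ≡sum f ⟩
    sum f ≈⟨ sum-cong-≋ {x = f} {y = g} f≃g ⟩
    sum g ≡⟨ Σₚ≡sum g ⟨
    Σₚ g  ∎

  Σₚ-distrib-+ : ∀ {k} (f g : Fin k → ℤp p) → Σₚ (λ i → f i +ₚ g i) ≃ Σₚ f +ₚ Σₚ g
  Σₚ-distrib-+ f g = begin
    Σₚ (λ i → f i +ₚ g i)  ≡⟨ Σₚ≡sum (λ i → f i +ₚ g i) ⟩
    sum (λ i → f i +ₚ g i) ≈⟨ ∑-distrib-+ f g ⟩
    sum f +ₚ sum g         ≡⟨ cong₂ _+ₚ_ (Σₚ≡sum f) (Σₚ≡sum g) ⟨
    Σₚ f +ₚ Σₚ g           ∎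

  *-distribˡ-Σₚ : ∀ {k} a (f : Fin k → ℤp p) → a *ₚ Σₚ f ≃ Σₚ (λ i → a *ₚ f i)
  *-distribˡ-Σₚ a f = begin
    a *ₚ Σₚ f              ≡⟨ cong (a *ₚ_) (Σₚ≡sum f) ⟩
    a *ₚ sum f             ≈⟨ *-distribˡ-sum a f ⟩
    sum (λ i → a *ₚ f i)   ≡⟨ Σₚ≡sum (λ i → a *ₚ f i) ⟨
    Σₚ (λ i → a *ₚ f i)    ∎

  Σₚ-comm : ∀ {k m} (f : Fin k → Fin m → ℤp p) → Σₚ (λ i → Σₚ (f i)) ≃ Σₚ (λ j → Σₚ (λ i → f i j))
  Σₚ-comm f = begin
    Σₚ (λ i → Σₚ (f i))             ≡⟨ ≡.trans (Σₚ≡sum _) (sum-cong-≗ λ i → Σₚ≡sum (f i)) ⟩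
    sum (λ i → sum (f i))           ≈⟨ ∑-comm f ⟩
    sum (λ j → sum (λ i → f i j))   ≡⟨ ≡.trans (Σₚ≡sum _) (sum-cong-≗ λ j → Σₚ≡sum (λ i → f i j)) ⟨
    Σₚ (λ j → Σₚ (λ i → f i j))     ∎

  infix 4 _≋_
  _≋_ : ∀ {n} → Vecₚ {p} n → Vecₚ n → Set
  x ≋ y = ∀ i → x i ≃ y i

  module _ {n : ℕ} where
    private
      V = Vecₚ {p} n

    ≋-refl : {x : V} → x ≋ x
    ≋-refl i = ≃-refl

    ≋-sym : {x y : V} → x ≋ y → y ≋ x
    ≋-sym x≋y i = ≃-sym (x≋y i)

    ≋-trans : {x y z : V} → x ≋ y → y ≋ z → x ≋ z
    ≋-trans x≋y y≋z i = ≃-trans (x≋y i) (y≋z i)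

    ≈ᵥ⇒≋ : {x y : V} → x ≈ᵥ y → x ≋ y
    ≈ᵥ⇒≋ x≈y i = mk≃ (x≈y i)

    ≋⇒≈ᵥ : {x y : V} → x ≋ y → x ≈ᵥ y
    ≋⇒≈ᵥ x≋y i = ≃⇒≈ (x≋y i)

    +ᵥ-cong : {x x′ y y′ : V} → x ≋ x′ → y ≋ y′ → x +ᵥ y ≋ x′ +ᵥ y′
    +ᵥ-cong x≋x′ y≋y′ i = +-cong (x≋x′ i) (y≋y′ i)

    ·ᵥ-congʳ : ∀ a {x y : V} → x ≋ y → a ·ᵥ x ≋ a ·ᵥ y
    ·ᵥ-congʳ a x≋y i = *-congˡ {a} (x≋y i)

    x≋a·u+[-a·u+x] : ∀ a (u x : V) → x ≋ a ·ᵥ u +ᵥ ((-ₚ a) ·ᵥ u +ᵥ x)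
    x≋a·u+[-a·u+x] a u x i = ≃-sym (begin
      a *ₚ u i +ₚ ((-ₚ a) *ₚ u i +ₚ x i) ≈⟨ +-assoc (a *ₚ u i) ((-ₚ a) *ₚ u i) (x i) ⟨
      a *ₚ u i +ₚ (-ₚ a) *ₚ u i +ₚ x i   ≈⟨ +-congʳ {x i} a·uᵢ-a·uᵢ≃0 ⟩
      0ₚ +ₚ x i                          ≈⟨ +-identityˡ (x i) ⟩
      x i                                ∎)
      where
      a·uᵢ-a·uᵢ≃0 : a *ₚ u i +ₚ (-ₚ a) *ₚ u i ≃ 0ₚ
      a·uᵢ-a·uᵢ≃0 = ≃-trans (+-comm (a *ₚ u i) ((-ₚ a) *ₚ u i)) ([-a]*b+a*b≃0 a (u i))

    lincomb-zero : ∀ {k} (g : Fin k → V) → lincomb g (λ _ → 0ₚ) ≋ 0ᵥ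
    lincomb-zero {zero}  g i = ≃-refl
    lincomb-zero {suc k} g i = ≃-trans (+-cong (zeroˡ (g zero i)) (lincomb-zero (g ∘ suc) i)) (+-identityˡ 0ₚ)

    lincomb-+ : ∀ {k} (g : Fin k → V) c d → lincomb g (λ j → c j +ₚ d j) ≋ lincomb g c +ᵥ lincomb g d
    lincomb-+ {zero}  g c d i = ≃-sym (+-identityˡ 0ₚ)
    lincomb-+ {suc k} g c d i =
      ≃-trans (+-cong (distribʳ (g zero i) (c zero) (d zero)) (lincomb-+ (g ∘ suc) (c ∘ suc) (d ∘ suc) i))
              (+-interchange (c zero *ₚ g zero i) (d zero *ₚ g zero i)
                             (lincomb (g ∘ suc) (c ∘ suc) i) (lincomb (g ∘ suc) (d ∘ suc) i))

    lincomb-· : ∀ {k} (g : Fin k → V) a c → lincomb g (λ j → a *ₚ c j) ≋ a ·ᵥ lincomb g c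
    lincomb-· {zero}  g a c i = ≃-sym (zeroʳ a)
    lincomb-· {suc k} g a c i =
      ≃-trans (+-cong (*-assoc a (c zero) (g zero i)) (lincomb-· (g ∘ suc) a (c ∘ suc) i))
              (≃-sym (distribˡ a (c zero *ₚ g zero i) (lincomb (g ∘ suc) (c ∘ suc) i)))

    -- x ∈⟨ g ⟩ as a record, so that x and g are inferable; a family only seen through g ∘ suc or
    -- g ▹ u still has to be given explicitly.
    infix 4 _∈ℤₚ[_]
    record _∈ℤₚ[_] {k} (x : V) (g : Fin k → V) : Set where
      constructor lincomb-of
      field
        coeff    : Fin k → ℤp p
        ≋lincomb : x ≋ lincomb g coeff

    ∈⟨⟩⇒∈ℤₚ[] : ∀ {k} {g : Fin k → V} {x} → x ∈⟨ g ⟩ → x ∈ℤₚ[ g ]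
    ∈⟨⟩⇒∈ℤₚ[] (c , x≈gc) = lincomb-of c (≈ᵥ⇒≋ x≈gc)

    ∈ℤₚ[]⇒∈⟨⟩ : ∀ {k} {g : Fin k → V} {x} → x ∈ℤₚ[ g ] → x ∈⟨ g ⟩
    ∈ℤₚ[]⇒∈⟨⟩ (lincomb-of c x≋gc) = c , ≋⇒≈ᵥ x≋gc

    module _ {k} {g : Fin k → V} where

      ∈ℤₚ[]-resp-≋ : ∀ {x y} → x ≋ y → y ∈ℤₚ[ g ] → x ∈ℤₚ[ g ]
      ∈ℤₚ[]-resp-≋ x≋y (lincomb-of c y≋gc) = lincomb-of c (≋-trans x≋y y≋gc)

      lincomb-∈ℤₚ[] : ∀ c → lincomb g c ∈ℤₚ[ g ]
      lincomb-∈ℤₚ[] c = lincomb-of c ≋-refl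

      0ᵥ-∈ℤₚ[] : 0ᵥ ∈ℤₚ[ g ]
      0ᵥ-∈ℤₚ[] = lincomb-of (λ _ → 0ₚ) (≋-sym (lincomb-zero g))

      +ᵥ-∈ℤₚ[] : ∀ {x y} → x ∈ℤₚ[ g ] → y ∈ℤₚ[ g ] → (x +ᵥ y) ∈ℤₚ[ g ]
      +ᵥ-∈ℤₚ[] (lincomb-of c x≋gc) (lincomb-of d y≋gd) =
        lincomb-of (λ j → c j +ₚ d j) (≋-trans (+ᵥ-cong x≋gc y≋gd) (≋-sym (lincomb-+ g c d)))

      ·ᵥ-∈ℤₚ[] : ∀ a {x} → x ∈ℤₚ[ g ] → (a ·ᵥ x) ∈ℤₚ[ g ]
      ·ᵥ-∈ℤₚ[] a (lincomb-of c x≋gc) =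
        lincomb-of (λ j → a *ₚ c j) (≋-trans (·ᵥ-congʳ a x≋gc) (≋-sym (lincomb-· g a c)))

    module _ {k} {g : Fin (suc k) → V} where

      ∈ℤₚ[]-cons : ∀ a {y} → y ∈ℤₚ[ g ∘ suc ] → (a ·ᵥ g zero +ᵥ y) ∈ℤₚ[ g ]
      ∈ℤₚ[]-cons a (lincomb-of c y≋gc) = lincomb-of (a ∷ c) (λ i → +-congˡ {a *ₚ g zero i} (y≋gc i))

      ∈ℤₚ[]-uncons : ∀ {x} → x ∈ℤₚ[ g ] →
                     Σ (ℤp p) λ a → Σ V λ y → y ∈ℤₚ[ g ∘ suc ] × x ≋ a ·ᵥ g zero +ᵥ y
      ∈ℤₚ[]-uncons (lincomb-of c x≋gc) = c zero , lincomb (g ∘ suc) (c ∘ suc) , lincomb-∈ℤₚ[] (c ∘ suc) , x≋gc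

    generator-∈ℤₚ[] : ∀ {k} (g : Fin k → V) j → g j ∈ℤₚ[ g ]
    generator-∈ℤₚ[] g zero    = ∈ℤₚ[]-resp-≋ g₀≋1·g₀+0 (∈ℤₚ[]-cons 1ₚ 0ᵥ-∈ℤₚ[])
      where
      g₀≋1·g₀+0 : g zero ≋ 1ₚ ·ᵥ g zero +ᵥ 0ᵥ
      g₀≋1·g₀+0 i = ≃-sym (≃-trans (+-identityʳ (1ₚ *ₚ g zero i)) (*-identityˡ (g zero i)))
    generator-∈ℤₚ[] g (suc j) = ∈ℤₚ[]-resp-≋ gⱼ₊₁≋0·g₀+gⱼ₊₁ (∈ℤₚ[]-cons 0ₚ (generator-∈ℤₚ[] (g ∘ suc) j))
      where
      gⱼ₊₁≋0·g₀+gⱼ₊₁ : g (suc j) ≋ 0ₚ ·ᵥ g zero +ᵥ g (suc j)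
      gⱼ₊₁≋0·g₀+gⱼ₊₁ i = ≃-sym (≃-trans (+-congʳ {g (suc j) i} (zeroˡ (g zero i))) (+-identityˡ (g (suc j) i)))

    module _ {m} {h : Fin m → V} where

      lincomb-∈ℤₚ[]-⊆ : ∀ {k} {g : Fin k → V} → (∀ j → g j ∈ℤₚ[ h ]) → ∀ c → lincomb g c ∈ℤₚ[ h ]
      lincomb-∈ℤₚ[]-⊆ {zero}  g⊆h c = 0ᵥ-∈ℤₚ[]
      lincomb-∈ℤₚ[]-⊆ {suc k} g⊆h c =
        +ᵥ-∈ℤₚ[] (·ᵥ-∈ℤₚ[] (c zero) (g⊆h zero)) (lincomb-∈ℤₚ[]-⊆ (g⊆h ∘ suc) (c ∘ suc))

      ∈ℤₚ[]-⊆ : ∀ {k} {g : Fin k → V} → (∀ j → g j ∈ℤₚ[ h ]) → ∀ {x} → x ∈ℤₚ[ g ] → x ∈ℤₚ[ h ]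
      ∈ℤₚ[]-⊆ g⊆h (lincomb-of c x≋gc) = ∈ℤₚ[]-resp-≋ x≋gc (lincomb-∈ℤₚ[]-⊆ g⊆h c)

    record Complementary {k m} (g : Fin k → V) (h : Fin m → V) : Set where
      field
        decompose : ∀ x → Σ V λ a → Σ V λ b → a ∈ℤₚ[ g ] × b ∈ℤₚ[ h ] × x ≋ a +ᵥ b
        disjoint  : ∀ {x} → x ∈ℤₚ[ g ] → x ∈ℤₚ[ h ] → x ≋ 0ᵥ

    DirectSumDecomp⇒Complementary : ∀ {k m} {g : Fin k → V} {h : Fin m → V} →
                                    DirectSumDecomp g h → Complementary g h
    DirectSumDecomp⇒Complementary (decompose , disjoint) = record
      { decompose = λ x → let (a , b , a∈g , b∈h , x≈a+b) = decompose x in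
          a , b , ∈⟨⟩⇒∈ℤₚ[] a∈g , ∈⟨⟩⇒∈ℤₚ[] b∈h , ≈ᵥ⇒≋ x≈a+b
      ; disjoint = λ {x} x∈g x∈h → ≈ᵥ⇒≋ (disjoint x (∈ℤₚ[]⇒∈⟨⟩ x∈g) (∈ℤₚ[]⇒∈⟨⟩ x∈h)) }

    Complementary⇒DirectSumDecomp : ∀ {k m} {g : Fin k → V} {h : Fin m → V} →
                                    Complementary g h → DirectSumDecomp g h
    Complementary⇒DirectSumDecomp g⊕h =
        (λ x → let (a , b , a∈g , b∈h , x≋a+b) = decompose x in
          a , b , ∈ℤₚ[]⇒∈⟨⟩ a∈g , ∈ℤₚ[]⇒∈⟨⟩ b∈h , ≋⇒≈ᵥ x≋a+b)
      , (λ x x∈g x∈h → ≋⇒≈ᵥ (disjoint {x} (∈⟨⟩⇒∈ℤₚ[] x∈g) (∈⟨⟩⇒∈ℤₚ[] x∈h)))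
      where open Complementary g⊕h

    module _ (G : Gram {p} n) where

      B-+ʳ : ∀ x y z → B G x (y +ᵥ z) ≃ B G x y +ₚ B G x z
      B-+ʳ x y z = begin
        B G x (y +ᵥ z)
          ≈⟨ Σₚ-cong _ _ (λ i → Σₚ-cong _ _ λ j → distribˡ (x i *ₚ G i j) (y j) (z j)) ⟩
        Σₚ (λ i → Σₚ (λ j → x i *ₚ G i j *ₚ y j +ₚ x i *ₚ G i j *ₚ z j))
          ≈⟨ Σₚ-cong _ _ (λ i → Σₚ-distrib-+ (λ j → x i *ₚ G i j *ₚ y j) (λ j → x i *ₚ G i j *ₚ z j)) ⟩
        Σₚ (λ i → Σₚ (λ j → x i *ₚ G i j *ₚ y j) +ₚ Σₚ (λ j → x i *ₚ G i j *ₚ z j))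
          ≈⟨ Σₚ-distrib-+ (λ i → Σₚ (λ j → x i *ₚ G i j *ₚ y j)) (λ i → Σₚ (λ j → x i *ₚ G i j *ₚ z j)) ⟩
        B G x y +ₚ B G x z ∎

      B-·ʳ : ∀ x a y → B G x (a ·ᵥ y) ≃ a *ₚ B G x y
      B-·ʳ x a y = begin
        B G x (a ·ᵥ y)
          ≈⟨ Σₚ-cong _ _ (λ i → Σₚ-cong _ _ λ j → x∙yz≈y∙xz (x i *ₚ G i j) a (y j)) ⟩
        Σₚ (λ i → Σₚ (λ j → a *ₚ (x i *ₚ G i j *ₚ y j)))
          ≈⟨ Σₚ-cong _ _ (λ i → *-distribˡ-Σₚ a (λ j → x i *ₚ G i j *ₚ y j)) ⟨
        Σₚ (λ i → a *ₚ Σₚ (λ j → x i *ₚ G i j *ₚ y j))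
          ≈⟨ *-distribˡ-Σₚ a (λ i → Σₚ (λ j → x i *ₚ G i j *ₚ y j)) ⟨
        a *ₚ B G x y ∎

      B-congʳ : ∀ x {y z} → y ≋ z → B G x y ≃ B G x z
      B-congʳ x {y} {z} y≋z = begin
        B G x y ≈⟨ Σₚ-cong _ _ (λ i → Σₚ-cong _ _ λ j → *-congˡ {x i *ₚ G i j} (y≋z j)) ⟩
        B G x z ∎

      B-sym : Symmetric G → ∀ x y → B G x y ≃ B G y x
      B-sym G-sym x y = begin
        B G x y                                    ≈⟨ Σₚ-comm (λ i j → x i *ₚ G i j *ₚ y j) ⟩
        Σₚ (λ j → Σₚ (λ i → x i *ₚ G i j *ₚ y j)) ≈⟨ Σₚ-cong _ _ (λ j → Σₚ-cong _ _ λ i → xGy≃yGx i j) ⟩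
        B G y x                                    ∎
        where
        xGy≃yGx : ∀ i j → x i *ₚ G i j *ₚ y j ≃ y j *ₚ G j i *ₚ x i
        xGy≃yGx i j = ≃-trans (xy∙z≈zy∙x (x i) (G i j) (y j)) (*-congʳ {x i} (*-congˡ {y j} Gᵢⱼ≃Gⱼᵢ))
          where
          Gᵢⱼ≃Gⱼᵢ : G i j ≃ G j i
          Gᵢⱼ≃Gⱼᵢ = mk≃ (G-sym i j)

      B-0ʳ : ∀ x → B G x 0ᵥ ≃ 0ₚ
      B-0ʳ x = begin
        B G x 0ᵥ           ≈⟨ B-congʳ x (λ i → ≃-sym (zeroˡ 0ₚ)) ⟩
        B G x (0ₚ ·ᵥ 0ᵥ)   ≈⟨ B-·ʳ x 0ₚ 0ᵥ ⟩
        0ₚ *ₚ B G x 0ᵥ     ≈⟨ zeroˡ (B G x 0ᵥ) ⟩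
        0ₚ                 ∎

      B-·+ʳ : ∀ x a y z → B G x (a ·ᵥ y +ᵥ z) ≃ a *ₚ B G x y +ₚ B G x z
      B-·+ʳ x a y z = ≃-trans (B-+ʳ x (a ·ᵥ y) z) (+-congʳ {B G x z} (B-·ʳ x a y))

      infix 4 _⊥ℤₚ[_]
      _⊥ℤₚ[_] : ∀ {k} → V → (Fin k → V) → Set
      x ⊥ℤₚ[ g ] = ∀ {y} → y ∈ℤₚ[ g ] → B G x y ≃ 0ₚ

      ⊥-generators⇒⊥ℤₚ[] : ∀ {k} {x} {g : Fin k → V} → (∀ j → B G x (g j) ≃ 0ₚ) → x ⊥ℤₚ[ g ]
      ⊥-generators⇒⊥ℤₚ[] {x = x} x⊥g (lincomb-of c y≋gc) = ≃-trans (B-congʳ x y≋gc) (⊥lincomb x⊥g c)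
        where
        ⊥lincomb : ∀ {k} {g : Fin k → V} → (∀ j → B G x (g j) ≃ 0ₚ) → ∀ c → B G x (lincomb g c) ≃ 0ₚ
        ⊥lincomb {zero}      x⊥g c = B-0ʳ x
        ⊥lincomb {suc k} {g} x⊥g c = begin
          B G x (c zero ·ᵥ g zero +ᵥ lincomb (g ∘ suc) (c ∘ suc))
            ≈⟨ B-·+ʳ x (c zero) (g zero) (lincomb (g ∘ suc) (c ∘ suc)) ⟩
          c zero *ₚ B G x (g zero) +ₚ B G x (lincomb (g ∘ suc) (c ∘ suc))
            ≈⟨ +-cong (*-congˡ {c zero} (x⊥g zero)) (⊥lincomb {g = g ∘ suc} (x⊥g ∘ suc) (c ∘ suc)) ⟩
          c zero *ₚ 0ₚ +ₚ 0ₚ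
            ≈⟨ ≃-trans (+-identityʳ (c zero *ₚ 0ₚ)) (zeroʳ (c zero)) ⟩
          0ₚ ∎

      B-⊥-summand : ∀ {k} {x} {N : Fin k → V} → x ⊥ℤₚ[ N ] →
                    ∀ {y a b} → a ∈ℤₚ[ N ] → y ≋ a +ᵥ b → B G x b ≃ B G x y
      B-⊥-summand {x = x} x⊥N {y} {a} {b} a∈N y≋a+b = begin
        B G x b                ≈⟨ +-identityˡ (B G x b) ⟨
        0ₚ +ₚ B G x b          ≈⟨ +-congʳ {B G x b} (x⊥N a∈N) ⟨
        B G x a +ₚ B G x b     ≈⟨ B-+ʳ x a b ⟨
        B G x (a +ᵥ b)         ≈⟨ B-congʳ x y≋a+b ⟨
        B G x y                ∎

      ⊥⟨⟩⇒⊥ℤₚ[] : ∀ {k} x (g : Fin k → V) → (∀ y → y ∈⟨ g ⟩ → B G x y ≈ 0ₚ) → x ⊥ℤₚ[ g ]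
      ⊥⟨⟩⇒⊥ℤₚ[] x g x⊥g {y} y∈g = mk≃ (x⊥g y (∈ℤₚ[]⇒∈⟨⟩ y∈g))

      module _ (G-sym : Symmetric G) {k} {N : Fin k → V} (v w : V)
               (v⊥N : v ⊥ℤₚ[ N ]) (w⊥N▹v : w ⊥ℤₚ[ N ▹ v ]) where

        B[v,v+w]≃B[v,v] : B G v (v +ᵥ w) ≃ B G v v
        B[v,v+w]≃B[v,v] = ≃-trans (B-+ʳ v v w) (≃-trans (+-congˡ {B G v v} B[v,w]≃0) (+-identityʳ (B G v v)))
          where
          B[v,w]≃0 : B G v w ≃ 0ₚ
          B[v,w]≃0 = ≃-trans (B-sym G-sym v w) (w⊥N▹v (generator-∈ℤₚ[] (N ▹ v) zero))

        N⊥v+w : ∀ {x} → x ∈ℤₚ[ N ] → B G x (v +ᵥ w) ≃ 0ₚ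
        N⊥v+w {x} x∈N = ≃-trans (B-+ʳ x v w) (≃-trans (+-cong B[x,v]≃0 B[x,w]≃0) (+-identityʳ 0ₚ))
          where
          B[x,v]≃0 : B G x v ≃ 0ₚ
          B[x,v]≃0 = ≃-trans (B-sym G-sym x v) (v⊥N x∈N)
          B[x,w]≃0 : B G x w ≃ 0ₚ
          B[x,w]≃0 = ≃-trans (B-sym G-sym x w) (w⊥N▹v (∈ℤₚ[]-⊆ {h = N ▹ v} (generator-∈ℤₚ[] (N ▹ v) ∘ suc) x∈N))

      module _ (v : V) where

        B[v,L]⊆ℤₚB[v,v] : Set
        B[v,L]⊆ℤₚB[v,v] = ∀ x → Σ (ℤp p) λ a → B G v x ≃ a *ₚ B G v v

        orthogonalSummand⇒B[v,L]⊆ℤₚB[v,v] : OrthogonalSummand G ⟨ v ⟩₁ → B[v,L]⊆ℤₚB[v,v]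
        orthogonalSummand⇒B[v,L]⊆ℤₚB[v,v] (_ , h , (decompose , _) , ⟨v⟩⊥h) x = quotient (decompose x)
          where
          quotient : (Σ V λ a → Σ V λ b → a ∈⟨ ⟨ v ⟩₁ ⟩ × b ∈⟨ h ⟩ × x ≈ᵥ a +ᵥ b) →
                     Σ (ℤp p) λ a → B G v x ≃ a *ₚ B G v v
          quotient (a , b , (c , a≈c·v) , b∈h , x≈a+b) = c zero , (begin
            B G v x                          ≈⟨ B-congʳ v x≋a+b ⟩
            B G v (a +ᵥ b)                   ≈⟨ B-+ʳ v a b ⟩
            B G v a +ₚ B G v b               ≈⟨ +-cong (B-congʳ v a≋c·v) B[v,b]≃0 ⟩
            B G v (c zero ·ᵥ v +ᵥ 0ᵥ) +ₚ 0ₚ  ≈⟨ +-identityʳ (B G v (c zero ·ᵥ v +ᵥ 0ᵥ)) ⟩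
            B G v (c zero ·ᵥ v +ᵥ 0ᵥ)        ≈⟨ B-·+ʳ v (c zero) v 0ᵥ ⟩
            c zero *ₚ B G v v +ₚ B G v 0ᵥ    ≈⟨ +-congˡ {c zero *ₚ B G v v} (B-0ʳ v) ⟩
            c zero *ₚ B G v v +ₚ 0ₚ          ≈⟨ +-identityʳ (c zero *ₚ B G v v) ⟩
            c zero *ₚ B G v v                ∎)
            where
            x≋a+b : x ≋ a +ᵥ b
            x≋a+b = ≈ᵥ⇒≋ x≈a+b
            a≋c·v : a ≋ c zero ·ᵥ v +ᵥ 0ᵥ
            a≋c·v = ≈ᵥ⇒≋ a≈c·v
            B[v,b]≃0 : B G v b ≃ 0ₚ
            B[v,b]≃0 = mk≃ (⟨v⟩⊥h v b (∈ℤₚ[]⇒∈⟨⟩ (generator-∈ℤₚ[] ⟨ v ⟩₁ zero)) b∈h)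

        B[v,v]≄0 : Nondegenerate G → ¬ v ≈ᵥ 0ᵥ → B[v,L]⊆ℤₚB[v,v] → ¬ B G v v ≃ 0ₚ
        B[v,v]≄0 nondegenerate v≉0 quot β≃0 = v≉0 (nondegenerate v λ y → ≃⇒≈ (begin
          B G v y                    ≈⟨ proj₂ (quot y) ⟩
          proj₁ (quot y) *ₚ B G v v  ≈⟨ *-congˡ {proj₁ (quot y)} β≃0 ⟩
          proj₁ (quot y) *ₚ 0ₚ       ≈⟨ zeroʳ (proj₁ (quot y)) ⟩
          0ₚ                         ∎))

        module _ (cancelβ : NonZeroDivisor (B G v v)) where

          ker∩ℤₚ[]⊆ℤₚ[tail] : ∀ {k} {g : Fin (suc k) → V} → v ⊥ℤₚ[ g ∘ suc ] → B G v (g zero) ≃ B G v v →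
                              ∀ {x} → x ∈ℤₚ[ g ] → B G v x ≃ 0ₚ → x ∈ℤₚ[ g ∘ suc ]
          ker∩ℤₚ[]⊆ℤₚ[tail] {g = g} v⊥tail B[v,g₀]≃β {x} x∈g B[v,x]≃0 = tail-part (∈ℤₚ[]-uncons {g = g} x∈g)
            where
            tail-part : (Σ (ℤp p) λ a → Σ V λ y → y ∈ℤₚ[ g ∘ suc ] × x ≋ a ·ᵥ g zero +ᵥ y) → x ∈ℤₚ[ g ∘ suc ]
            tail-part (a , y , y∈tail , x≋a·g₀+y) = ∈ℤₚ[]-resp-≋ x≋y y∈tail
              where
              a≃0 : a ≃ 0ₚ
              a≃0 = cancelβ a (begin
                a *ₚ B G v v                     ≈⟨ *-congˡ {a} B[v,g₀]≃β ⟨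
                a *ₚ B G v (g zero)              ≈⟨ +-identityʳ (a *ₚ B G v (g zero)) ⟨
                a *ₚ B G v (g zero) +ₚ 0ₚ        ≈⟨ +-congˡ {a *ₚ B G v (g zero)} (v⊥tail y∈tail) ⟨
                a *ₚ B G v (g zero) +ₚ B G v y   ≈⟨ B-·+ʳ v a (g zero) y ⟨
                B G v (a ·ᵥ g zero +ᵥ y)         ≈⟨ B-congʳ v x≋a·g₀+y ⟨
                B G v x                          ≈⟨ B[v,x]≃0 ⟩
                0ₚ                               ∎)
              x≋y : x ≋ y
              x≋y i = begin
                x i                       ≈⟨ x≋a·g₀+y i ⟩
                a *ₚ g zero i +ₚ y i      ≈⟨ +-congʳ {y i} (≃-trans (*-congʳ {g zero i} a≃0) (zeroˡ (g zero i))) ⟩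
                0ₚ +ₚ y i                 ≈⟨ +-identityˡ (y i) ⟩
                y i                       ∎

          ker∩ℤₚ[u]≋0 : ∀ {u} → B G v u ≃ B G v v → ∀ {x} → x ∈ℤₚ[ ⟨ u ⟩₁ ] → B G v x ≃ 0ₚ → x ≋ 0ᵥ
          ker∩ℤₚ[u]≋0 {u} B[v,u]≃β x∈u B[v,x]≃0 = _∈ℤₚ[_].≋lincomb
            (ker∩ℤₚ[]⊆ℤₚ[tail] {g = ⟨ u ⟩₁} (⊥-generators⇒⊥ℤₚ[] {g = ⟨ u ⟩₁ ∘ suc} λ ()) B[v,u]≃β x∈u B[v,x]≃0)

          orthogonalSum-line : ∀ {k} {N : Fin k → V} {u} → (∀ {x} → x ∈ℤₚ[ N ] → B G x u ≃ 0ₚ) →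
                               v ⊥ℤₚ[ N ] → B G v u ≃ B G v v → OrthogonalSum G N ⟨ u ⟩₁
          orthogonalSum-line {u = u} N⊥u v⊥N B[v,u]≃β =
              (λ x y x∈N y∈u → ≃⇒≈ (⊥-generators⇒⊥ℤₚ[] {x = x} {g = ⟨ u ⟩₁} (λ _ → N⊥u {x} (∈⟨⟩⇒∈ℤₚ[] x∈N))
                                      {y} (∈⟨⟩⇒∈ℤₚ[] y∈u)))
            , (λ x x∈N x∈u → ≋⇒≈ᵥ (ker∩ℤₚ[u]≋0 {u} B[v,u]≃β {x} (∈⟨⟩⇒∈ℤₚ[] x∈u) (v⊥N {x} (∈⟨⟩⇒∈ℤₚ[] x∈N))))

          module _ (quot : B[v,L]⊆ℤₚB[v,v]) where

            private
              γ : V → ℤp p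
              γ x = proj₁ (quot x)

            B[v,-γx·z+x]≃0 : ∀ z → B G v z ≃ B G v v → ∀ x → B G v ((-ₚ γ x) ·ᵥ z +ᵥ x) ≃ 0ₚ
            B[v,-γx·z+x]≃0 z B[v,z]≃β x = begin
              B G v ((-ₚ γ x) ·ᵥ z +ᵥ x)              ≈⟨ B-·+ʳ v (-ₚ γ x) z x ⟩
              (-ₚ γ x) *ₚ B G v z +ₚ B G v x          ≈⟨ +-cong (*-congˡ { -ₚ γ x} B[v,z]≃β) (proj₂ (quot x)) ⟩
              (-ₚ γ x) *ₚ B G v v +ₚ γ x *ₚ B G v v   ≈⟨ [-a]*b+a*b≃0 (γ x) (B G v v) ⟩
              0ₚ                                      ∎

            module _ {k m} {N : Fin k → V} {h : Fin m → V} (N⊕h : Complementary N h) (v⊥N : v ⊥ℤₚ[ N ])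
                     {u} (B[v,u]≃β : B G v u ≃ B G v v) where
              open Complementary N⊕h

              module _ {k₀} (k₀∈h : k₀ ∈ℤₚ[ h ]) (B[v,k₀]≃β : B G v k₀ ≃ B G v v) where

                -- the projection of h j to ker B(v,·) along k₀
                C : Fin m → V
                C j = (-ₚ γ (h j)) ·ᵥ k₀ +ᵥ h j

                v⊥C : v ⊥ℤₚ[ C ]
                v⊥C = ⊥-generators⇒⊥ℤₚ[] {g = C} (λ j → B[v,-γx·z+x]≃0 k₀ B[v,k₀]≃β (h j))

                C⊆h : ∀ j → C j ∈ℤₚ[ h ]
                C⊆h j = +ᵥ-∈ℤₚ[] {g = h} (·ᵥ-∈ℤₚ[] {g = h} (-ₚ γ (h j)) k₀∈h) (generator-∈ℤₚ[] h j)

                h⊆C▹k₀ : ∀ j → h j ∈ℤₚ[ C ▹ k₀ ]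
                h⊆C▹k₀ j = ∈ℤₚ[]-resp-≋ {g = C ▹ k₀} (x≋a·u+[-a·u+x] (γ (h j)) k₀ (h j))
                  (∈ℤₚ[]-cons {g = C ▹ k₀} (γ (h j)) (generator-∈ℤₚ[] C j))

                ker∩ℤₚ[h]⊆ℤₚ[C] : ∀ {x} → x ∈ℤₚ[ h ] → B G v x ≃ 0ₚ → x ∈ℤₚ[ C ]
                ker∩ℤₚ[h]⊆ℤₚ[C] x∈h =
                  ker∩ℤₚ[]⊆ℤₚ[tail] {g = C ▹ k₀} v⊥C B[v,k₀]≃β (∈ℤₚ[]-⊆ {h = C ▹ k₀} h⊆C▹k₀ x∈h)

                N▹u⊕C : Complementary (N ▹ u) C
                N▹u⊕C = record { decompose = decompose′ ; disjoint = disjoint′ }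
                  where
                  decompose′ : ∀ x → Σ V λ a → Σ V λ b → a ∈ℤₚ[ N ▹ u ] × b ∈ℤₚ[ C ] × x ≋ a +ᵥ b
                  decompose′ x = regroup (decompose ((-ₚ γ x) ·ᵥ u +ᵥ x))
                    where
                    regroup : (Σ V λ a → Σ V λ b → a ∈ℤₚ[ N ] × b ∈ℤₚ[ h ] × (-ₚ γ x) ·ᵥ u +ᵥ x ≋ a +ᵥ b) →
                              Σ V λ a → Σ V λ b → a ∈ℤₚ[ N ▹ u ] × b ∈ℤₚ[ C ] × x ≋ a +ᵥ b
                    regroup (a , b , a∈N , b∈h , y≋a+b) =
                        γ x ·ᵥ u +ᵥ a , b
                      , ∈ℤₚ[]-cons {g = N ▹ u} (γ x) a∈N , ker∩ℤₚ[h]⊆ℤₚ[C] b∈h B[v,b]≃0 , x≋[γx·u+a]+b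
                      where
                      B[v,b]≃0 : B G v b ≃ 0ₚ
                      B[v,b]≃0 = ≃-trans (B-⊥-summand v⊥N a∈N y≋a+b) (B[v,-γx·z+x]≃0 u B[v,u]≃β x)
                      x≋[γx·u+a]+b : x ≋ (γ x ·ᵥ u +ᵥ a) +ᵥ b
                      x≋[γx·u+a]+b i = begin
                        x i                                     ≈⟨ x≋a·u+[-a·u+x] (γ x) u x i ⟩
                        γ x *ₚ u i +ₚ ((-ₚ γ x) *ₚ u i +ₚ x i)  ≈⟨ +-congˡ {γ x *ₚ u i} (y≋a+b i) ⟩
                        γ x *ₚ u i +ₚ (a i +ₚ b i)              ≈⟨ +-assoc (γ x *ₚ u i) (a i) (b i) ⟨
                        γ x *ₚ u i +ₚ a i +ₚ b i                ∎
                  disjoint′ : ∀ {x} → x ∈ℤₚ[ N ▹ u ] → x ∈ℤₚ[ C ] → x ≋ 0ᵥ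
                  disjoint′ x∈N▹u x∈C = disjoint (ker∩ℤₚ[]⊆ℤₚ[tail] {g = N ▹ u} v⊥N B[v,u]≃β x∈N▹u (v⊥C x∈C))
                                                 (∈ℤₚ[]-⊆ {h = h} C⊆h x∈C)

              extension-complement : Σ (Fin m → V) λ C → Complementary (N ▹ u) C
              extension-complement = from-summands (decompose u)
                where
                from-summands : (Σ V λ n₀ → Σ V λ k₀ → n₀ ∈ℤₚ[ N ] × k₀ ∈ℤₚ[ h ] × u ≋ n₀ +ᵥ k₀) →
                                Σ (Fin m → V) λ C → Complementary (N ▹ u) C
                from-summands (n₀ , k₀ , n₀∈N , k₀∈h , u≋n₀+k₀) = C k₀∈h B[v,k₀]≃β , N▹u⊕C k₀∈h B[v,k₀]≃β
                  where
                  B[v,k₀]≃β : B G v k₀ ≃ B G v v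
                  B[v,k₀]≃β = ≃-trans (B-⊥-summand v⊥N n₀∈N u≋n₀+k₀) B[v,u]≃β

            primitive-extension : ∀ {k} {N : Fin k → V} {u} → Primitive N → v ⊥ℤₚ[ N ] → B G v u ≃ B G v v →
                                  Primitive (N ▹ u)
            primitive-extension {N = N} {u} (m , h , N⊕h) v⊥N B[v,u]≃β =
              m , proj₁ complement , Complementary⇒DirectSumDecomp (proj₂ complement)
              where
              complement : Σ (Fin m → V) λ C → Complementary (N ▹ u) C
              complement = extension-complement (DirectSumDecomp⇒Complementary N⊕h) v⊥N B[v,u]≃β

lemma2p7 : (p : ℕ) → Prime p → (n : ℕ) → (G : Gram {p} n) → Symmetric G → Nondegenerate G →
    (k : ℕ) → (N : Fin k → Vecₚ {p} n) → Primitive N →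
    (v : Vecₚ n) → ¬ (v ≈ᵥ 0ᵥ) → OrthogonalSummand G ⟨ v ⟩₁ →
    (∀ x → x ∈⟨ N ⟩ → B G v x ≈ 0ₚ) →
    (w : Vecₚ n) → (∀ x → x ∈⟨ N ▹ v ⟩ → B G w x ≈ 0ₚ) →
    OrthogonalSum G N ⟨ v +ᵥ w ⟩₁ × Primitive (N ▹ (v +ᵥ w))
lemma2p7 p p-prime n G G-sym G-nondeg k N N-primitive v v≉0 v-summand v⊥N w w⊥N▹v =
    orthogonalSum-line G v cancelβ {u = v +ᵥ w} (N⊥v+w G G-sym v w v⊥ℤₚ[N] w⊥ℤₚ[N▹v]) v⊥ℤₚ[N] B[v,v+w]≃β
  , primitive-extension G v cancelβ quot {u = v +ᵥ w} N-primitive v⊥ℤₚ[N] B[v,v+w]≃β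
  where
  quot : B[v,L]⊆ℤₚB[v,v] G v
  quot = orthogonalSummand⇒B[v,L]⊆ℤₚB[v,v] G v v-summand
  cancelβ : NonZeroDivisor (B G v v)
  cancelβ = ℤₚ-noZeroDivisors p-prime (B[v,v]≄0 G v G-nondeg v≉0 quot)
  v⊥ℤₚ[N] : _⊥ℤₚ[_] G v N
  v⊥ℤₚ[N] = ⊥⟨⟩⇒⊥ℤₚ[] G v N v⊥N
  w⊥ℤₚ[N▹v] : _⊥ℤₚ[_] G w (N ▹ v)
  w⊥ℤₚ[N▹v] = ⊥⟨⟩⇒⊥ℤₚ[] G w (N ▹ v) w⊥N▹v
  B[v,v+w]≃β : B G v (v +ᵥ w) ≃ B G v v
  B[v,v+w]≃β = B[v,v+w]≃B[v,v] G G-sym v w v⊥ℤₚ[N] w⊥ℤₚ[N▹v]
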